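{- Let $T=(t_i)_{i\le n}$ be an Erdős–Szekeres tableau and $P=P(T)$ its order poset. If $t_i$ hooks $t_j$, then $i<_P j$. If $t_i$ slices $t_j$, then $i>_P j$.
   Context: For a sequence $A=(a_1,\dots,a_n)$ of distinct reals, $a_i^+$ (resp. $a_i^-$) is the length of the longest increasing (resp. decreasing) subsequence ending at $a_i$; the EST is $T(A)=((a_i^+,a_i^-))_{i\le n}$. Write $t_i=(x_i,y_i)$ and $T_j=\{t_1,\dots,t_j\}$. $\mathrm{Col}(x,y)=\{(x,y'): y'>y\}$, $\mathrm{Row}(x,y)=\{(x',y): x'>x\}$. For $i<j$: $t_i$ hooks $t_j$ if there is an integer $x$ with $x_i\le x\le x_j$ and $\mathrm{Col}(x,y_i)\cap T_j=\emptyset$; $t_i$ slices $t_j$ if there is an integer $y$ with $y_i\le y\le y_j$ and $\mathrm{Row}(x_i,y)\cap T_j=\emptyset$. A sequence $A$ is identified with the linear order $i<_A j$ iff $a_i<a_j$ on $[n]$; $[T]$ is the set of such orders with $T(A)=T$; $P(T)$ on $[n]$ has $i<_{P(T)}j$ iff $i<_A j$ for all $A\in[T]$. -}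

module Defs where

open import Data.Nat using (ℕ; suc; _≤_; _<_)
open import Data.Fin using (Fin; fromℕ) renaming (_<_ to _<ᶠ_; _≤_ to _≤ᶠ_)
open import Data.Product using (Σ; _×_; _,_; proj₁; proj₂; ∃-syntax)
open import Relation.Binary.PropositionalEquality using (_≡_)
open import Relation.Nullary using (¬_)
open import Function.Definitions using (Injective)

-- A sequence of n distinct numbers, indexed by Fin n (positions 1..n shifted to 0..n-1).
-- Only the relative order matters, so ℕ-valued injective sequences realise every
-- linear order on [n] (= every order type of distinct reals).
Distinct : {n : ℕ} → (Fin n → ℕ) → Set
Distinct a = Injective _≡_ _≡_ a

IncSeqEndingAt : {n : ℕ} → (Fin n → ℕ) → Fin n → ℕ → Set
IncSeqEndingAt {n} a i m =
  Σ (Fin (suc m) → Fin n) λ s →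
    ((p q : Fin (suc m)) → p <ᶠ q → (s p <ᶠ s q) × (a (s p) < a (s q)))
    × (s (fromℕ m) ≡ i)

DecSeqEndingAt : {n : ℕ} → (Fin n → ℕ) → Fin n → ℕ → Set
DecSeqEndingAt {n} a i m =
  Σ (Fin (suc m) → Fin n) λ s →
    ((p q : Fin (suc m)) → p <ᶠ q → (s p <ᶠ s q) × (a (s q) < a (s p)))
    × (s (fromℕ m) ≡ i)

IsLongestInc : {n : ℕ} → (Fin n → ℕ) → Fin n → ℕ → Set
IsLongestInc a i ℓ =
  (∃[ m ] (suc m ≡ ℓ × IncSeqEndingAt a i m))
  × ((m : ℕ) → IncSeqEndingAt a i m → suc m ≤ ℓ)

IsLongestDec : {n : ℕ} → (Fin n → ℕ) → Fin n → ℕ → Set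
IsLongestDec a i ℓ =
  (∃[ m ] (suc m ≡ ℓ × DecSeqEndingAt a i m))
  × ((m : ℕ) → DecSeqEndingAt a i m → suc m ≤ ℓ)

Tableau : ℕ → Set
Tableau n = Fin n → ℕ × ℕ

xc : {n : ℕ} → Tableau n → Fin n → ℕ
xc T i = proj₁ (T i)

yc : {n : ℕ} → Tableau n → Fin n → ℕ
yc T i = proj₂ (T i)

HasEST : {n : ℕ} → (Fin n → ℕ) → Tableau n → Set
HasEST a T = ∀ i → IsLongestInc a i (xc T i) × IsLongestDec a i (yc T i)

InClass : {n : ℕ} → Tableau n → (Fin n → ℕ) → Set
InClass T a = Distinct a × HasEST a T

IsEST : {n : ℕ} → Tableau n → Set
IsEST T = ∃[ a ] InClass T a

LtP : {n : ℕ} → Tableau n → Fin n → Fin n → Set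
LtP T i j = ∀ a → InClass T a → a i < a j

-- t_i hooks t_j : ∃ integer x, x_i ≤ x ≤ x_j, Col(x, y_i) ∩ T_j = ∅.
Hooks : {n : ℕ} → Tableau n → Fin n → Fin n → Set
Hooks {n} T i j = ∃[ x ] (xc T i ≤ x × x ≤ xc T j ×
  ((k : Fin n) → k ≤ᶠ j → ¬ (xc T k ≡ x × yc T i < yc T k)))

-- t_i slices t_j : ∃ integer y, y_i ≤ y ≤ y_j, Row(x_i, y) ∩ T_j = ∅.
Slices : {n : ℕ} → Tableau n → Fin n → Fin n → Set
Slices {n} T i j = ∃[ y ] (yc T i ≤ y × y ≤ yc T j ×
  ((k : Fin n) → k ≤ᶠ j → ¬ (yc T k ≡ y × xc T i < xc T k)))

module Submission where

-- Fix A ∈ [T] and positions i < j.  Hooks and slices are handled by one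
-- argument, run once for increasing subsequences and once for decreasing
-- ones, so it is developed for chains of an arbitrary transitive and
-- irreflexive relation R on the values (R = _<_ resp. R = flip _<_).
--  * Chains: an R-chain ending at i extends by any later k with R a_i a_k,
--    and dropping its last entry leaves an R-chain ending at the
--    penultimate entry.
--  * Lengths: hence the longest-chain length L increases strictly along
--    R-steps, and walking back along a longest chain ending at j attains
--    every length 1 ≤ x ≤ L j at some k ≤ j with k = j or R a_k a_j.
--  * Blocking: if R a_j a_i, take such a k for the x of the hook.  Then
--    k < i contradicts monotonicity of L, k = i irreflexivity of R, and
--    k > i puts t_k into the column that the hook declares empty.
-- So a hook excludes a_j < a_i and a slice excludes a_i < a_j; since the
-- values of A are distinct, this yields a_i < a_j resp. a_j < a_i.

open import Defs
open import Data.Nat using (ℕ; zero; suc; _+_; _∸_; _≤_; _<_; s≤s; z≤n; s≤s⁻¹)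
import Data.Nat.Properties as ℕ
open import Data.Fin using (Fin; fromℕ; inject₁) renaming (_<_ to _<ᶠ_; _≤_ to _≤ᶠ_)
import Data.Fin.Properties as Fin
open import Data.Fin.Relation.Unary.Top using (View; view; ‵fromℕ; ‵inj₁; view-fromℕ)
open import Data.Product using (Σ; _×_; _,_; proj₁; proj₂; ∃-syntax)
open import Data.Sum using (_⊎_; inj₁; inj₂; [_,_])
open import Data.Empty using (⊥; ⊥-elim)
open import Function using (_∘_; flip)
open import Relation.Nullary using (¬_)
open import Relation.Binary.Definitions using (Tri; tri<; tri≈; tri>)
open import Relation.Binary.PropositionalEquality using (_≡_; _≢_; refl; sym; trans; cong; subst; subst₂)

inject₁-preserves-< : ∀ {m} {p q : Fin m} → p <ᶠ q → inject₁ p <ᶠ inject₁ q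
inject₁-preserves-< {p = p} {q} = subst₂ _<_ (sym (Fin.toℕ-inject₁ p)) (sym (Fin.toℕ-inject₁ q))

inject₁-reflects-< : ∀ {m} {p q : Fin m} → inject₁ p <ᶠ inject₁ q → p <ᶠ q
inject₁-reflects-< {p = p} {q} = subst₂ _<_ (Fin.toℕ-inject₁ p) (Fin.toℕ-inject₁ q)

fromℕ-maximal : ∀ {m} (q : Fin (suc m)) → ¬ (fromℕ m <ᶠ q)
fromℕ-maximal q = ℕ.≤⇒≯ (Fin.≤fromℕ q)

inject₁<fromℕ : ∀ {m} (p : Fin m) → inject₁ p <ᶠ fromℕ m
inject₁<fromℕ {suc m} p = Fin.≤̄⇒inject₁< (Fin.≤fromℕ p)

module Chains (R : ℕ → ℕ → Set) (R-trans : ∀ {u v w} → R u v → R v w → R u w)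
              {n : ℕ} (a : Fin n → ℕ) where

  IsChain : ∀ {m} → (Fin m → Fin n) → Set
  IsChain {m} s = (p q : Fin m) → p <ᶠ q → (s p <ᶠ s q) × R (a (s p)) (a (s q))

  -- R-chains of length suc m ending at position i.  For R = _<_ and
  -- R = flip _<_ this is, by definition, IncSeqEndingAt resp. DecSeqEndingAt.
  Chain : Fin n → ℕ → Set
  Chain i m = Σ (Fin (suc m) → Fin n) λ s → IsChain s × (s (fromℕ m) ≡ i)

  Longest : Fin n → ℕ → Set
  Longest i ℓ = (∃[ m ] (suc m ≡ ℓ × Chain i m)) × ((m : ℕ) → Chain i m → suc m ≤ ℓ)

  snoc-at : ∀ {m} → (Fin (suc m) → Fin n) → Fin n → {q : Fin (suc (suc m))} → View q → Fin n
  snoc-at s k ‵fromℕ = k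
  snoc-at s k (‵inj₁ {i = p} _) = s p

  snoc : ∀ {m} → (Fin (suc m) → Fin n) → Fin n → Fin (suc (suc m)) → Fin n
  snoc s k q = snoc-at s k (view q)

  below-end : ∀ {m i k} (s : Fin (suc m) → Fin n) → IsChain s → s (fromℕ m) ≡ i →
              i <ᶠ k → R (a i) (a k) → ∀ p → (s p <ᶠ k) × R (a (s p)) (a k)
  below-end s chain refl i<k ik p with view p
  ... | ‵fromℕ = i<k , ik
  ... | ‵inj₁ {i = p′} _ = Fin.<-trans (proj₁ step) i<k , R-trans (proj₂ step) ik
    where step = chain (inject₁ p′) (fromℕ _) (inject₁<fromℕ p′)

  extend : ∀ {i k m} → Chain i m → i <ᶠ k → R (a i) (a k) → Chain k (suc m)
  extend {i} {k} {m} (s , chain , end) i<k ik = snoc s k , snoc-chain , snoc-last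
    where
    snoc-chain : IsChain (snoc s k)
    snoc-chain p q p<q with view p | view q
    ... | ‵inj₁ {i = p′} _ | ‵inj₁ {i = q′} _ = chain p′ q′ (inject₁-reflects-< p<q)
    ... | ‵inj₁ {i = p′} _ | ‵fromℕ = below-end s chain end i<k ik p′
    ... | ‵fromℕ | _ = ⊥-elim (fromℕ-maximal q p<q)
    snoc-last : snoc s k (fromℕ (suc m)) ≡ k
    snoc-last = cong (snoc-at s k) (view-fromℕ (suc m))

  penultimate : ∀ {j m} → Chain j (suc m) → Fin n
  penultimate {m = m} (s , _) = s (inject₁ (fromℕ m))

  penultimate-step : ∀ {j m} (c : Chain j (suc m)) → (penultimate c <ᶠ j) × R (a (penultimate c)) (a j)
  penultimate-step {m = m} (s , chain , refl) = chain (inject₁ (fromℕ m)) (fromℕ (suc m)) (inject₁<fromℕ (fromℕ m))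

  prefix : ∀ {j m} (c : Chain j (suc m)) → Chain (penultimate c) m
  prefix (s , chain , _) = s ∘ inject₁ , (λ p q p<q → chain (inject₁ p) (inject₁ q) (inject₁-preserves-< p<q)) , refl

  -- Properties of the longest-chain length L (L = x-coordinates for R = _<_,
  -- y-coordinates for R = flip _<_).
  module Lengths (L : Fin n → ℕ) (longest : ∀ k → Longest k (L k)) where

    L-positive : ∀ k → 1 ≤ L k
    L-positive k = subst (1 ≤_) (proj₁ (proj₂ (proj₁ (longest k)))) (s≤s z≤n)

    L-increases : ∀ {i k} → i <ᶠ k → R (a i) (a k) → L i < L k
    L-increases {i} {k} i<k ik with proj₁ (longest i)
    ... | m , e , c = subst (_< L k) e (proj₂ (longest k) (suc m) (extend c i<k ik))

    predecessor : ∀ {j m} → suc (suc m) ≡ L j → (c : Chain j (suc m)) →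
                  ∃[ j′ ] (j′ <ᶠ j × R (a j′) (a j) × L j′ ≡ suc m)
    predecessor {j} {m} e c = j′ , j′<j , j′j , ℕ.≤-antisym at-most at-least
      where
      j′ = penultimate c
      j′<j = proj₁ (penultimate-step c)
      j′j = proj₂ (penultimate-step c)
      at-most : L j′ ≤ suc m
      at-most = s≤s⁻¹ (subst (L j′ <_) (sym e) (L-increases j′<j j′j))
      at-least : suc m ≤ L j′
      at-least = proj₂ (longest j′) m (prefix c)

    WeaklyBelow : Fin n → Fin n → Set
    WeaklyBelow k j = k ≡ j ⊎ R (a k) (a j)

    -- Walking back d steps from j along longest chains reaches length x.
    attained-from : ∀ d j {x} → 1 ≤ x → L j ≡ d + x →
                    ∃[ k ] (k ≤ᶠ j × L k ≡ x × WeaklyBelow k j)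
    attained-from zero j _ e = j , Fin.≤-refl , e , inj₁ refl
    attained-from (suc d) j {x} 1≤x e with proj₁ (longest j)
    ... | zero , e′ , _ = ⊥-elim (ℕ.<⇒≢ (ℕ.≤-trans 1≤x (ℕ.m≤n+m x d)) (ℕ.suc-injective (trans e′ e)))
    ... | suc m , e′ , c with predecessor e′ c
    ... | j′ , j′<j , j′j , Lj′ with attained-from d j′ 1≤x (trans Lj′ (ℕ.suc-injective (trans e′ e)))
    ... | k , k≤j′ , Lk , inj₁ refl = k , ℕ.<⇒≤ j′<j , Lk , inj₂ j′j
    ... | k , k≤j′ , Lk , inj₂ kj′ = k , Fin.≤-trans k≤j′ (ℕ.<⇒≤ j′<j) , Lk , inj₂ (R-trans kj′ j′j)

    attained : ∀ {j x} → 1 ≤ x → x ≤ L j → ∃[ k ] (k ≤ᶠ j × L k ≡ x × WeaklyBelow k j)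
    attained {j} {x} 1≤x x≤Lj = attained-from (L j ∸ x) j 1≤x (sym (ℕ.m∸n+n≡m x≤Lj))

module Blocking (R : ℕ → ℕ → Set) (R-trans : ∀ {u v w} → R u v → R v w → R u w)
                (R-irrefl : ∀ {u} → ¬ R u u) {n : ℕ} (a : Fin n → ℕ) (L L° : Fin n → ℕ)
                (longest : ∀ k → Chains.Longest R R-trans a k (L k))
                (longest° : ∀ k → Chains.Longest (flip R) (λ p q → R-trans q p) a k (L° k)) where

  open Chains.Lengths R R-trans a L longest using (L-positive; L-increases; attained)
  open Chains.Lengths (flip R) (λ p q → R-trans q p) a L° longest° using () renaming (L-increases to L°-increases)

  blocked : ∀ {i j x} → i <ᶠ j → L i ≤ x → x ≤ L j →
            (∀ k → k ≤ᶠ j → ¬ (L k ≡ x × L° i < L° k)) → ¬ R (a j) (a i)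
  blocked {i} {j} {x} i<j Li≤x x≤Lj empty r with attained (ℕ.≤-trans (L-positive i) Li≤x) x≤Lj
  ... | k , k≤j , Lk , k-below-j = by-position (Fin.<-cmp k i)
    where
    ki : R (a k) (a i)
    ki = [ (λ { refl → r }) , (λ kj → R-trans kj r) ] k-below-j
    by-position : Tri (k <ᶠ i) (k ≡ i) (i <ᶠ k) → ⊥
    by-position (tri< k<i _ _) = ℕ.<⇒≱ (L-increases k<i ki) (subst (L i ≤_) (sym Lk) Li≤x)
    by-position (tri≈ _ refl _) = R-irrefl ki
    by-position (tri> _ _ i<k) = empty k k≤j (Lk , L°-increases i<k ki)

hook-excludes-descent : ∀ {n} (T : Tableau n) (a : Fin n → ℕ) → HasEST a T →
                        ∀ {i j} → i <ᶠ j → Hooks T i j → ¬ (a j < a i)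
hook-excludes-descent T a est i<j (x , xi≤x , x≤xj , empty) =
  Blocking.blocked _<_ ℕ.<-trans (ℕ.<-irrefl refl) a (xc T) (yc T)
    (proj₁ ∘ est) (proj₂ ∘ est) i<j xi≤x x≤xj empty

slice-excludes-ascent : ∀ {n} (T : Tableau n) (a : Fin n → ℕ) → HasEST a T →
                        ∀ {i j} → i <ᶠ j → Slices T i j → ¬ (a i < a j)
slice-excludes-ascent T a est i<j (y , yi≤y , y≤yj , empty) =
  Blocking.blocked (flip _<_) (flip ℕ.<-trans) (ℕ.<-irrefl refl) a (yc T) (xc T)
    (proj₂ ∘ est) (proj₁ ∘ est) i<j yi≤y y≤yj empty

strict-from-exclusion : ∀ {n} {a : Fin n → ℕ} → Distinct a →
                        ∀ {i j} → i ≢ j → ¬ (a j < a i) → a i < a j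
strict-from-exclusion distinct i≢j aj≮ai = ℕ.≤∧≢⇒< (ℕ.≮⇒≥ aj≮ai) (i≢j ∘ distinct)

corollary1 : (n : ℕ) (T : Tableau n) → IsEST T → (i j : Fin n) → i <ᶠ j →
    (Hooks T i j → LtP T i j) × (Slices T i j → LtP T j i)
corollary1 n T _ i j i<j =
  (λ hook a (distinct , est) →
     strict-from-exclusion distinct i≢j (hook-excludes-descent T a est i<j hook)) ,
  (λ slice a (distinct , est) →
     strict-from-exclusion distinct (i≢j ∘ sym) (slice-excludes-ascent T a est i<j slice))
  where
  i≢j : i ≢ j
  i≢j = Fin.<⇒≢ i<j
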